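{- Let $k$ be a nonnegative integer and $S\in\mathsf{APS}^B_{2k+1}\setminus\mathsf{APS}^D_{2k+1}$. Then for every $w\in\mathfrak{S}_{2k+1}^B$ whose pinnacle set is $S$, every value $w(i)$ ($i\in[2k+1]$) that is not a pinnacle of $w$ is negative.
   Context: $[n]=\{1,\dots,n\}$, $\pm[n]=[n]\cup-[n]$. $\mathfrak{S}_n^B$ is the group of bijections $w:\pm[n]\to\pm[n]$ with $w(-i)=-w(i)$, written in one-line notation $w(1)\cdots w(n)$; $\mathfrak{S}_n^D\subseteq\mathfrak{S}_n^B$ consists of those $w$ with $|\{i\in[n]:w(i)<0\}|$ even. A pinnacle of $w$ is a value $w(i)$ with $2\le i\le n-1$ and $w(i-1)<w(i)>w(i+1)$; the pinnacle set of $w$ is the set of its pinnacles. $\mathsf{APS}^B_n$ (resp. $\mathsf{APS}^D_n$) is the set of pinnacle sets of elements of $\mathfrak{S}_n^B$ (resp. $\mathfrak{S}_n^D$). -}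

module Defs where

open import Data.Nat using (ℕ; suc; zero; _+_; _*_)
open import Data.Nat.Properties using ()
open import Data.Fin using (Fin; toℕ)
open import Data.Bool using (Bool; true; false; T)
open import Relation.Nullary.Decidable using (T?)
open import Data.Integer using (ℤ; +_; -_; _<_)
open import Data.Product using (Σ; ∃; _×_; _,_; proj₁; proj₂)
open import Data.List using (List; filter; length; allFin)
open import Relation.Nullary using (¬_)
open import Function.Bundles using (_⇔_)
open import Data.Fin.Permutation using (Permutation′; _⟨$⟩ʳ_)
open import Relation.Binary.PropositionalEquality using (_≡_)
open import Level using (0ℓ)

-- A signed permutation w ∈ 𝔖ᴮ_n : an underlying permutation σ of [n]
-- together with a sign for each position; true = negative.
-- w(i) = ± (σ(i) + 1), with i, σ(i) in Fin n (0-based).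
record SignedPerm (n : ℕ) : Set where
  constructor sp
  field
    perm : Permutation′ n
    neg  : Fin n → Bool

open SignedPerm public

val : ∀ {n} → SignedPerm n → Fin n → ℤ
val w i with neg w i
... | true  = - (+ suc (toℕ (perm w ⟨$⟩ʳ i)))
... | false = + suc (toℕ (perm w ⟨$⟩ʳ i))

negCount : ∀ {n} → SignedPerm n → ℕ
negCount {n} w = length (filter (λ i → T? (neg w i)) (allFin n))

IsTypeD : ∀ {n} → SignedPerm n → Set
IsTypeD w = Σ ℕ λ m → negCount w ≡ 2 * m

IsPinnacle : ∀ {n} → SignedPerm n → ℤ → Set
IsPinnacle {n} w v =
  Σ (Fin n) λ a → Σ (Fin n) λ b → Σ (Fin n) λ c →
    (toℕ b ≡ suc (toℕ a)) × (toℕ c ≡ suc (toℕ b)) ×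
    (val w b ≡ v) × (val w a < val w b) × (val w c < val w b)

ZSet : Set₁
ZSet = ℤ → Set

HasPinnacleSet : ∀ {n} → SignedPerm n → ZSet → Set
HasPinnacleSet w S = ∀ v → IsPinnacle w v ⇔ S v

InAPSB : ℕ → ZSet → Set
InAPSB n S = Σ (SignedPerm n) λ w → HasPinnacleSet w S

InAPSD : ℕ → ZSet → Set
InAPSD n S = Σ (SignedPerm n) λ w → IsTypeD w × HasPinnacleSet w S

{-# OPTIONS --safe #-}
-- Suppose w(i) > 0 is not a pinnacle. It suffices to find a position r such that changing
-- the sign of w(r) keeps the pinnacle set: this changes the parity of the number of
-- negative entries, so w or its flip is of type D. Flipping w(i) itself keeps every
-- pinnacle and can only create a new one at a neighbour j with - w(i) < w(j) < w(i).
-- If w(j) < 0, flipping w(j) instead works; if w(j) > 0, then w(j) is a smaller positive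
-- non-pinnacle and we descend.
module Submission where

open import Defs
open import Data.Nat using (ℕ; suc; _*_)
open import Data.Fin using (Fin)
open import Data.Integer using (_<_; 0ℤ)
open import Relation.Nullary using (¬_)

open import Data.Bool using (Bool; true; false; not; if_then_else_)
open import Data.Empty using (⊥-elim)
open import Data.Fin using (zero; suc; toℕ; _≟_)
open import Data.Fin.Permutation using (_⟨$⟩ʳ_)
open import Data.Fin.Properties using (toℕ-injective; any?)
open import Data.Integer using (ℤ; +_; -_; -[1+_]; +<+; ∣_∣) renaming (_<?_ to _<ℤ?_)
open import Data.Integer.Properties using (<-trans; <-asym; <-cmp; neg-involutive; neg-mono-<)
open import Data.List using (filter; length; tabulate)
import Data.Nat as ℕ
open import Data.Nat.Induction using (<-wellFounded)
open import Data.Nat.Properties using (suc-injective; <-irrefl; n<1+n; *-suc)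
open import Data.Product using (∃; _×_; _,_; proj₁; proj₂)
open import Data.Sum using (_⊎_; inj₁; inj₂; swap)
open import Data.Vec.Functional using (Vector; head; tail; updateAt)
open import Data.Vec.Functional.Properties using (updateAt-updates; updateAt-minimal)
open import Function using (_∘_)
open import Function.Bundles using (_⇔_; mk⇔; Injection)
open import Function.Construct.Composition using (_⇔-∘_)
open import Function.Construct.Symmetry using (⇔-sym)
open import Function.Properties.Inverse using (↔⇒↣)
open import Induction.WellFounded using (Acc; acc)
open import Relation.Binary using (tri<; tri≈; tri>)
open import Relation.Binary.PropositionalEquality using (_≡_; _≢_; refl; sym; trans; cong; subst; subst₂; module ≡-Reasoning)
open import Relation.Nullary using (Dec; yes; no)
open import Relation.Nullary.Decidable using (_×-dec_; _⊎-dec_; T?)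

private
  variable
    n : ℕ
    i j : ℤ

_⋖_ : Fin n → Fin n → Set
a ⋖ b = toℕ b ≡ suc (toℕ a)

⋖-injectiveˡ : ∀ {a b c : Fin n} → a ⋖ c → b ⋖ c → a ≡ b
⋖-injectiveˡ a⋖c b⋖c = toℕ-injective (suc-injective (trans (sym a⋖c) b⋖c))

⋖-injectiveʳ : ∀ {a b c : Fin n} → a ⋖ b → a ⋖ c → b ≡ c
⋖-injectiveʳ a⋖b a⋖c = toℕ-injective (trans a⋖b (sym a⋖c))

⋖-irrefl : ∀ {a : Fin n} → ¬ a ⋖ a
⋖-irrefl {a = a} a⋖a = <-irrefl a⋖a (n<1+n (toℕ a))

Adjacent : Fin n → Fin n → Set
Adjacent r j = r ⋖ j ⊎ j ⋖ r

Adjacent-sym : ∀ {r j : Fin n} → Adjacent r j → Adjacent j r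
Adjacent-sym (inj₁ r⋖j) = inj₂ r⋖j
Adjacent-sym (inj₂ j⋖r) = inj₁ j⋖r

Adjacent⇒≢ : ∀ {r j : Fin n} → Adjacent r j → j ≢ r
Adjacent⇒≢ (inj₁ r⋖j) refl = ⋖-irrefl r⋖j
Adjacent⇒≢ (inj₂ j⋖r) refl = ⋖-irrefl j⋖r

Adjacent? : (r j : Fin n) → Dec (Adjacent r j)
Adjacent? r j = (toℕ j ℕ.≟ suc (toℕ r)) ⊎-dec (toℕ r ℕ.≟ suc (toℕ j))

Peak : (Fin n → ℤ) → Fin n → Set
Peak f b = ∃ λ a → ∃ λ c → a ⋖ b × b ⋖ c × f a < f b × f c < f b

Peak? : (f : Fin n → ℤ) (b : Fin n) → Dec (Peak f b)
Peak? f b = any? λ a → any? λ c →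
  (toℕ b ℕ.≟ suc (toℕ a)) ×-dec (toℕ c ℕ.≟ suc (toℕ b)) ×-dec (f a <ℤ? f b) ×-dec (f c <ℤ? f b)

-- IsPinnacle w is definitionally Pinnacle (val w).
Pinnacle : (Fin n → ℤ) → ℤ → Set
Pinnacle {n} f v = ∃ λ (a : Fin n) → ∃ λ b → ∃ λ c →
  a ⋖ b × b ⋖ c × f b ≡ v × f a < f b × f c < f b

SamePinnacles : (Fin n → ℤ) → (Fin n → ℤ) → Set
SamePinnacles f g = ∀ v → Pinnacle f v ⇔ Pinnacle g v

EqualOff : Fin n → (Fin n → ℤ) → (Fin n → ℤ) → Set
EqualOff r f g = ∀ j → j ≢ r → f j ≡ g j

peak-above-adjacent : ∀ {f : Fin n → ℤ} {r j} → Adjacent r j → Peak f j → f r < f j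
peak-above-adjacent (inj₁ r⋖j) (a , c , a⋖j , j⋖c , fa<fj , fc<fj)
  rewrite ⋖-injectiveˡ r⋖j a⋖j = fa<fj
peak-above-adjacent (inj₂ j⋖r) (a , c , a⋖j , j⋖c , fa<fj , fc<fj)
  rewrite ⋖-injectiveʳ j⋖r j⋖c = fc<fj

peak-transfer : ∀ {f g : Fin n → ℤ} {r j} → EqualOff r f g →
  (∀ j → Adjacent r j → Peak f j → g r < f j) →
  j ≢ r → Peak f j → Peak g j
peak-transfer {f = f} {g} {r} {j} f≈g below-peaks j≢r pk@(a , c , a⋖j , j⋖c , fa<fj , fc<fj) =
  a , c , a⋖j , j⋖c , lower a (inj₁ a⋖j) fa<fj , lower c (inj₂ j⋖c) fc<fj
  where
  lower : ∀ x → Adjacent x j → f x < f j → g x < g j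
  lower x x~j fx<fj with x ≟ r
  ... | yes refl = subst (g x <_) (f≈g j j≢r) (below-peaks j x~j pk)
  ... | no x≢r = subst₂ _<_ (f≈g x x≢r) (f≈g j j≢r) fx<fj

pinnacle-transfer : ∀ {f g : Fin n → ℤ} {r v} → EqualOff r f g →
  (∀ j → Adjacent r j → Peak f j → g r < f j) →
  ¬ Peak f r → Pinnacle f v → Pinnacle g v
pinnacle-transfer {r = r} f≈g below-peaks ¬peak (a , b , c , a⋖b , b⋖c , fb≡v , fa<fb , fc<fb)
  with b ≟ r
... | yes refl = ⊥-elim (¬peak (a , c , a⋖b , b⋖c , fa<fb , fc<fb))
... | no b≢r with peak-transfer f≈g below-peaks b≢r (a , c , a⋖b , b⋖c , fa<fb , fc<fb)
...   | a′ , c′ , a′⋖b , b⋖c′ , ga′<gb , gc′<gb =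
        a′ , b , c′ , a′⋖b , b⋖c′ , trans (sym (f≈g b b≢r)) fb≡v , ga′<gb , gc′<gb

same-pinnacles : ∀ {f g : Fin n → ℤ} {r} → EqualOff r f g →
  (∀ j → Adjacent r j → Peak f j → g r < f j) →
  (∀ j → Adjacent r j → Peak g j → f r < g j) →
  ¬ Peak f r → ¬ Peak g r → SamePinnacles f g
same-pinnacles f≈g f→g g→f ¬peak-f ¬peak-g _ =
  mk⇔ (pinnacle-transfer f≈g f→g ¬peak-f)
      (pinnacle-transfer (λ j j≢r → sym (f≈g j j≢r)) g→f ¬peak-g)

peak-raise : ∀ {f g : Fin n → ℤ} {r} → EqualOff r f g → g r < f r → Peak g r → Peak f r
peak-raise f≈g gr<fr (a , c , a⋖r , r⋖c , ga<gr , gc<gr) =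
  a , c , a⋖r , r⋖c ,
  <-trans (subst (_< _) (sym (f≈g a (Adjacent⇒≢ (inj₂ a⋖r)))) ga<gr) gr<fr ,
  <-trans (subst (_< _) (sym (f≈g c (Adjacent⇒≢ (inj₁ r⋖c)))) gc<gr) gr<fr

0<i⇒-i<i : 0ℤ < i → - i < i
0<i⇒-i<i 0<i = <-trans (neg-mono-< 0<i) 0<i

i<0⇒i<-i : i < 0ℤ → i < - i
i<0⇒i<-i i<0 = <-trans i<0 (neg-mono-< i<0)

-i<j⇒-j<i : - i < j → - j < i
-i<j⇒-j<i {i} -i<j = subst (- _ <_) (neg-involutive i) (neg-mono-< -i<j)

∣∣-mono-<-pos : 0ℤ < i → i < j → ∣ i ∣ ℕ.< ∣ j ∣
∣∣-mono-<-pos {+ _} {+ _} _ (+<+ m<n) = m<n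
∣∣-mono-<-pos {+ _} { -[1+ _ ]} _ ()
∣∣-mono-<-pos { -[1+ _ ]} ()

module SignFlip
  (f : Fin n → ℤ)
  (f-injective : ∀ {a b} → f a ≡ f b → a ≡ b)
  (f-nonzero : ∀ a → f a ≢ 0ℤ)
  (flip : Fin n → Fin n → ℤ)
  (flip-at : ∀ r → flip r r ≡ - f r)
  (flip-off : ∀ r → EqualOff r f (flip r))
  where

  NewPeakBelow : Fin n → Set
  NewPeakBelow p = ∃ λ j → Adjacent p j × Peak (flip p) j × f j < f p

  NewPeakBelow? : ∀ p → Dec (NewPeakBelow p)
  NewPeakBelow? p = any? λ j → Adjacent? p j ×-dec Peak? (flip p) j ×-dec (f j <ℤ? f p)

  flip-positive : ∀ {p} → 0ℤ < f p → ¬ Peak f p → ¬ NewPeakBelow p → SamePinnacles f (flip p)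
  flip-positive {p} 0<fp ¬peak no-new-peak =
    same-pinnacles (flip-off p) f→g g→f ¬peak (¬peak ∘ peak-raise (flip-off p) gp<fp)
    where
    gp<fp : flip p p < f p
    gp<fp = subst (_< f p) (sym (flip-at p)) (0<i⇒-i<i 0<fp)
    f→g : ∀ j → Adjacent p j → Peak f j → flip p p < f j
    f→g j p~j pk = <-trans gp<fp (peak-above-adjacent p~j pk)
    g→f : ∀ j → Adjacent p j → Peak (flip p) j → f p < flip p j
    g→f j p~j pk with <-cmp (f j) (f p)
    ... | tri< fj<fp _ _ = ⊥-elim (no-new-peak (j , p~j , pk , fj<fp))
    ... | tri≈ _ fj≡fp _ = ⊥-elim (Adjacent⇒≢ p~j (f-injective fj≡fp))
    ... | tri> _ _ fp<fj = subst (f p <_) (flip-off p j (Adjacent⇒≢ p~j)) fp<fj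

  -- No neighbour lies strictly between f b and - f b, so no comparison with a neighbour changes.
  flip-negative : ∀ {b q} → f b < 0ℤ → Adjacent b q → - f b < f q →
    (∀ j → Adjacent b j → f b < f j → - f b < f j) → SamePinnacles f (flip b)
  flip-negative {b} {q} fb<0 b~q -fb<fq above⇒above-neg =
    same-pinnacles (flip-off b) f→g g→f ¬peak-f ¬peak-g
    where
    fb<-fb : f b < - f b
    fb<-fb = i<0⇒i<-i fb<0
    f→g : ∀ j → Adjacent b j → Peak f j → flip b b < f j
    f→g j b~j pk = subst (_< f j) (sym (flip-at b)) (above⇒above-neg j b~j (peak-above-adjacent b~j pk))
    g→f : ∀ j → Adjacent b j → Peak (flip b) j → f b < flip b j
    g→f j b~j pk = <-trans fb<-fb (subst (_< flip b j) (flip-at b) (peak-above-adjacent b~j pk))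
    ¬peak-f : ¬ Peak f b
    ¬peak-f pk = <-asym (peak-above-adjacent (Adjacent-sym b~q) pk) (<-trans fb<-fb -fb<fq)
    ¬peak-g : ¬ Peak (flip b) b
    ¬peak-g pk = <-asym -fb<fq
      (subst₂ _<_ (sym (flip-off b q (Adjacent⇒≢ b~q))) (flip-at b) (peak-above-adjacent (Adjacent-sym b~q) pk))

  flip-new-negative-peak : ∀ {p j} → f j < 0ℤ → Adjacent p j → Peak (flip p) j → SamePinnacles f (flip j)
  flip-new-negative-peak {p} {j} fj<0 p~j pk =
    flip-negative fj<0 (Adjacent-sym p~j) (-i<j⇒-j<i -fp<fj) above⇒above-neg
    where
    j≢p : j ≢ p
    j≢p = Adjacent⇒≢ p~j
    -fp<fj : - f p < f j
    -fp<fj = subst₂ _<_ (flip-at p) (sym (flip-off p j j≢p)) (peak-above-adjacent p~j pk)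
    above⇒above-neg : ∀ m → Adjacent j m → f j < f m → - f j < f m
    above⇒above-neg m j~m fj<fm with m ≟ p
    ... | yes refl = -i<j⇒-j<i -fp<fj
    ... | no m≢p = ⊥-elim (<-asym fj<fm
          (subst₂ _<_ (sym (flip-off p m m≢p)) (sym (flip-off p j j≢p)) (peak-above-adjacent (Adjacent-sym j~m) pk)))

  positive-non-peak⇒flippable : ∀ p → 0ℤ < f p → ¬ Peak f p → ∃ λ r → SamePinnacles f (flip r)
  positive-non-peak⇒flippable p = descend p (<-wellFounded ∣ f p ∣)
    where
    descend : ∀ p → Acc ℕ._<_ ∣ f p ∣ → 0ℤ < f p → ¬ Peak f p → ∃ λ r → SamePinnacles f (flip r)
    descend p (acc smaller) 0<fp ¬peak with NewPeakBelow? p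
    ... | no no-new-peak = p , flip-positive 0<fp ¬peak no-new-peak
    ... | yes (j , p~j , pk , fj<fp) with <-cmp (f j) 0ℤ
    ...   | tri< fj<0 _ _ = j , flip-new-negative-peak fj<0 p~j pk
    ...   | tri≈ _ fj≡0 _ = ⊥-elim (f-nonzero j fj≡0)
    ...   | tri> _ _ 0<fj = descend j (smaller (∣∣-mono-<-pos 0<fj fj<fp)) 0<fj
            (λ pkj → <-asym fj<fp (peak-above-adjacent p~j pkj))

flipSign : SignedPerm n → Fin n → SignedPerm n
flipSign w r = sp (perm w) (updateAt (neg w) r not)

signed : Bool → ℤ → ℤ
signed true i = - i
signed false i = i

val≡signed : (w : SignedPerm n) (i : Fin n) → val w i ≡ signed (neg w i) (+ suc (toℕ (perm w ⟨$⟩ʳ i)))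
val≡signed w i with neg w i
... | true = refl
... | false = refl

signed-not : ∀ b i → signed (not b) i ≡ - signed b i
signed-not true i = sym (neg-involutive i)
signed-not false i = refl

∣val∣ : (w : SignedPerm n) (i : Fin n) → ∣ val w i ∣ ≡ suc (toℕ (perm w ⟨$⟩ʳ i))
∣val∣ w i with neg w i
... | true = refl
... | false = refl

val-injective : (w : SignedPerm n) → ∀ {a b} → val w a ≡ val w b → a ≡ b
val-injective w {a} {b} eq = Injection.injective (↔⇒↣ (perm w))
  (toℕ-injective (suc-injective (trans (sym (∣val∣ w a)) (trans (cong ∣_∣ eq) (∣val∣ w b)))))

val-nonzero : (w : SignedPerm n) (i : Fin n) → val w i ≢ 0ℤ
val-nonzero w i with neg w i
... | true = λ ()
... | false = λ ()

val-flipSign-at : (w : SignedPerm n) (r : Fin n) → val (flipSign w r) r ≡ - val w r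
val-flipSign-at w r = begin
  val (flipSign w r) r                 ≡⟨ val≡signed (flipSign w r) r ⟩
  signed (updateAt (neg w) r not r) m  ≡⟨ cong (λ b → signed b m) (updateAt-updates r (neg w)) ⟩
  signed (not (neg w r)) m             ≡⟨ signed-not (neg w r) m ⟩
  - signed (neg w r) m                 ≡⟨ cong -_ (val≡signed w r) ⟨
  - val w r                            ∎
  where
  open ≡-Reasoning
  m : ℤ
  m = + suc (toℕ (perm w ⟨$⟩ʳ r))

val-flipSign-off : (w : SignedPerm n) (r : Fin n) → EqualOff r (val w) (val (flipSign w r))
val-flipSign-off w r j j≢r = begin
  val w j                                ≡⟨ val≡signed w j ⟩
  signed (neg w j) m                     ≡⟨ cong (λ b → signed b m) (updateAt-minimal j r (neg w) j≢r) ⟨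
  signed (updateAt (neg w) r not j) m    ≡⟨ val≡signed (flipSign w r) j ⟨
  val (flipSign w r) j                   ∎
  where
  open ≡-Reasoning
  m : ℤ
  m = + suc (toℕ (perm w ⟨$⟩ʳ j))

trueCount : Vector Bool n → ℕ
trueCount {ℕ.zero} _ = 0
trueCount {suc n} bs = if head bs then suc (trueCount (tail bs)) else trueCount (tail bs)

length-filter-tabulate : ∀ {m} {A : Set} (p : A → Bool) (h : Fin m → A) →
  length (filter (T? ∘ p) (tabulate h)) ≡ trueCount (p ∘ h)
length-filter-tabulate {ℕ.zero} p h = refl
length-filter-tabulate {suc m} p h with p (h zero)
... | true = cong suc (length-filter-tabulate p (h ∘ suc))
... | false = length-filter-tabulate p (h ∘ suc)

trueCount-updateAt-not : (bs : Vector Bool n) (r : Fin n) →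
  suc (trueCount bs) ≡ trueCount (updateAt bs r not) ⊎ trueCount bs ≡ suc (trueCount (updateAt bs r not))
trueCount-updateAt-not bs zero with head bs
... | true = inj₂ refl
... | false = inj₁ refl
trueCount-updateAt-not bs (suc r) with trueCount-updateAt-not (tail bs) r | head bs
... | ih | false = ih
... | inj₁ e | true = inj₁ (cong suc e)
... | inj₂ e | true = inj₂ (cong suc e)

Even : ℕ → Set
Even m = ∃ λ k → m ≡ 2 * k

even-or-even-suc : ∀ m → Even m ⊎ Even (suc m)
even-or-even-suc ℕ.zero = inj₁ (0 , refl)
even-or-even-suc (suc m) with even-or-even-suc m
... | inj₁ (k , m≡2k) = inj₂ (suc k , trans (cong (2 ℕ.+_) m≡2k) (sym (*-suc 2 k)))
... | inj₂ even-suc-m = inj₁ even-suc-m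

differByOne⇒even⊎even : ∀ {a b} → suc a ≡ b ⊎ a ≡ suc b → Even a ⊎ Even b
differByOne⇒even⊎even (inj₁ refl) = even-or-even-suc _
differByOne⇒even⊎even (inj₂ refl) = swap (even-or-even-suc _)

negCount≡trueCount : (w : SignedPerm n) → negCount w ≡ trueCount (neg w)
negCount≡trueCount w = length-filter-tabulate (neg w) (λ i → i)

isTypeD-or-flipSign-isTypeD : (w : SignedPerm n) (r : Fin n) → IsTypeD w ⊎ IsTypeD (flipSign w r)
isTypeD-or-flipSign-isTypeD w r =
  subst₂ (λ a b → Even a ⊎ Even b) (sym (negCount≡trueCount w)) (sym (negCount≡trueCount (flipSign w r)))
    (differByOne⇒even⊎even (trueCount-updateAt-not (neg w) r))

nonPinnacle-negative : (S : ZSet) → ¬ InAPSD n S → (w : SignedPerm n) → HasPinnacleSet w S →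
  (i : Fin n) → ¬ IsPinnacle w (val w i) → val w i < 0ℤ
nonPinnacle-negative S ∉APSᴰ w w↦S i non-pinnacle with <-cmp (val w i) 0ℤ
... | tri< wi<0 _ _ = wi<0
... | tri≈ _ wi≡0 _ = ⊥-elim (val-nonzero w i wi≡0)
... | tri> _ _ 0<wi = ⊥-elim (∉APSᴰ (typeD-witness (isTypeD-or-flipSign-isTypeD w r)))
  where
  open SignFlip (val w) (val-injective w) (val-nonzero w) (λ r → val (flipSign w r))
    (val-flipSign-at w) (val-flipSign-off w)
  non-peak : ¬ Peak (val w) i
  non-peak (a , c , a⋖i , i⋖c , wa<wi , wc<wi) = non-pinnacle (a , i , c , a⋖i , i⋖c , refl , wa<wi , wc<wi)
  flippable : ∃ λ r → SamePinnacles (val w) (val (flipSign w r))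
  flippable = positive-non-peak⇒flippable i 0<wi non-peak
  r : Fin _
  r = proj₁ flippable
  typeD-witness : IsTypeD w ⊎ IsTypeD (flipSign w r) → InAPSD _ S
  typeD-witness (inj₁ w-typeD) = w , w-typeD , w↦S
  typeD-witness (inj₂ w′-typeD) = flipSign w r , w′-typeD , λ v → w↦S v ⇔-∘ ⇔-sym (proj₂ flippable v)

-- The hypothesis S ∈ APSᴮ is implied by the existence of w.
lemma4p4 : (k : ℕ) (S : ZSet) →
    InAPSB (suc (2 * k)) S → ¬ InAPSD (suc (2 * k)) S →
    (w : SignedPerm (suc (2 * k))) → HasPinnacleSet w S →
    (i : Fin (suc (2 * k))) → ¬ IsPinnacle w (val w i) → val w i < 0ℤ
lemma4p4 k S _ = nonPinnacle-negative S
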